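{- Let $G$ be an equatorial graph with girth $g$ and equator $q$, let $k=\lceil g/2\rceil-1$, let $C=u_0,\dots,u_{q-1}$ be an isometric cycle of length $q$ in $G$, and let $L_i=\mathcal{D}_k(u_{i-k})\cap\mathcal{D}_k(u_{i+k})$ for $i\in\{0,\dots,q-1\}$ (indices mod $q$). If $u\in L_i$, then $u$ has a neighbor in $L_{i-1}$ and a neighbor in $L_{i+1}$.
   Context: For a vertex $u$, $\mathcal{D}_i(u)=\{v: d(u,v)\le i\}$. A cycle $C$ is isometric if $d_C(x,y)=d_G(x,y)$ for all $x,y\in V(C)$; the equator is the length of a longest isometric cycle. For $\delta\ge2$, $g\ge3$, $k=\lceil g/2\rceil-1$, the Moore bound is $M(\delta,g)=1+\sum_{i=0}^{k-1}\delta(\delta-1)^i$ for odd $g$ and $M(\delta,g)=2+\sum_{i=1}^{k}2(\delta-1)^i$ for even $g$. An equatorial graph is a finite graph with girth $g$, minimum degree $\delta$ and equator $q>6k+3$ whose order is exactly $\frac{q}{g}M(\delta,g)$. -}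

module Defs where

open import Data.Nat using (ℕ; zero; suc; _+_; _*_; _∸_; _^_; _≤_; _<_; _⊓_; ∣_-_∣; NonZero)
open import Data.Nat.DivMod using (_/_; _%_; m%n<n)
open import Data.Bool using (Bool; T)
open import Data.Fin using (Fin; toℕ; fromℕ<)
open import Data.Fin.Subset using (∣_∣)
open import Data.Vec using (tabulate)
open import Data.Product using (_×_; ∃; ∃-syntax; Σ)
open import Data.Sum using (_⊎_)
open import Function.Definitions using (Injective)
open import Relation.Binary.PropositionalEquality using (_≡_)

record Graph : Set where
  field
    n     : ℕ
    adj   : Fin n → Fin n → Bool
    sym   : ∀ u v → adj u v ≡ adj v u
    irref : ∀ u → adj u u ≡ Data.Bool.false

module _ (G : Graph) where
  open Graph G

  V : Set
  V = Fin n

  E : V → V → Set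
  E u v = T (adj u v)

  data Walk : V → V → ℕ → Set where
    nil  : ∀ {u} → Walk u u 0
    cons : ∀ {u w v l} → E u w → Walk w v l → Walk u v (suc l)

  DistLe : V → V → ℕ → Set
  DistLe u v i = ∃[ l ] (l ≤ i × Walk u v l)

  Dist : V → V → ℕ → Set
  Dist u v m = Walk u v m × (∀ l → Walk u v l → m ≤ l)

  Ball : ℕ → V → V → Set
  Ball i u v = DistLe u v i

  degree : V → ℕ
  degree u = ∣ tabulate (adj u) ∣

  record IsCycle (l : ℕ) (c : Fin l → V) : Set where
    field
      len≥3 : 3 ≤ l
      inj   : Injective _≡_ _≡_ c
      edges : ∀ (i j : Fin l) →
              (suc (toℕ i) ≡ toℕ j ⊎ (suc (toℕ i) ≡ l × toℕ j ≡ 0)) →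
              E (c i) (c j)

  dCyc : (l : ℕ) → Fin l → Fin l → ℕ
  dCyc l i j = ∣ toℕ i - toℕ j ∣ ⊓ (l ∸ ∣ toℕ i - toℕ j ∣)

  IsIsometricCycle : (l : ℕ) → (Fin l → V) → Set
  IsIsometricCycle l c = IsCycle l c × (∀ i j → Dist (c i) (c j) (dCyc l i j))

  HasGirth : ℕ → Set
  HasGirth g = (Σ (Fin g → V) (IsCycle g)) × (∀ l (c : Fin l → V) → IsCycle l c → g ≤ l)

  HasMinDegree : ℕ → Set
  HasMinDegree δ = (∀ u → δ ≤ degree u) × (∃[ u ] degree u ≡ δ)

  HasEquator : ℕ → Set
  HasEquator q = (Σ (Fin q → V) (IsIsometricCycle q))
               × (∀ l (c : Fin l → V) → IsIsometricCycle l c → l ≤ q)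

-- k = ⌈g/2⌉ - 1 = ⌊(g-1)/2⌋
kOf : ℕ → ℕ
kOf g = (g ∸ 1) / 2

sumTo : (ℕ → ℕ) → ℕ → ℕ
sumTo f zero    = 0
sumTo f (suc m) = sumTo f m + f m

moore : ℕ → ℕ → ℕ
moore δ g with g % 2
... | 1 = 1 + sumTo (λ i → δ * (δ ∸ 1) ^ i) (kOf g)
... | _ = 2 + sumTo (λ i → 2 * (δ ∸ 1) ^ suc i) (kOf g)

-- Equatorial graph: girth g, minimum degree δ, equator q > 6k+3,
-- and order n = (q/g) M(δ,g), i.e. n * g = q * M(δ,g).
record Equatorial (G : Graph) (δ g q : ℕ) : Set where
  field
    δ≥2    : 2 ≤ δ
    g≥3    : 3 ≤ g
    girth  : HasGirth G g
    mindeg : HasMinDegree G δ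
    equat  : HasEquator G q
    q-big  : 6 * kOf g + 3 < q
    order  : Graph.n G * g ≡ q * moore δ g

at : ∀ {A : Set} {q} .{{_ : NonZero q}} → (Fin q → A) → ℕ → A
at {q = q} c j = c (fromℕ< (m%n<n j q))

-- L_j = D_k(u_{j-k}) ∩ D_k(u_{j+k}), indices mod q (j - k written as j + q ∸ k)
InL : (G : Graph) (k q : ℕ) .{{_ : NonZero q}} → (Fin q → V G) → ℕ → V G → Set
InL G k q c j v = Ball G k (at c (j + q ∸ k)) v × Ball G k (at c (j + k)) v

-- Write g = 2k + 1 + e with e ∈ {0, 1}, and along the isometric cycle let the window W_s be
-- D_k(u_s) ∪ D_k(u_{s+e}). By the girth, the non-backtracking walks of length at most k from u_s
-- (and from u_{s+1} when e = 1) form a tree of distinct vertices, so |W_s| ≥ M(δ,g) and the q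
-- windows have total size at least q M(δ,g) = n g. As the cycle is isometric and q > 6k + 3,
-- two windows at cyclic distance at least g are disjoint, so every vertex lies in at most g
-- windows, hence in exactly g; in particular, if all windows containing a vertex are among
-- W_b, …, W_{b+g-1}, then it lies in W_b. For u ∈ L_i, let w be its neighbour on a shortest path
-- to u_{i+k+1} through u_{i+k}. Then w lies in no window beyond W_{i+k+1}, hence in the first
-- window that can still contain it, which forces w ∈ D_k(u_{i-k+1}), i.e. w ∈ L_{i+1}.
-- Reversing the orientation of the cycle gives the neighbour in L_{i-1}.

module Submission where

open import Defs
open import Data.Nat using (ℕ; suc; _+_; _∸_; NonZero)
open import Data.Fin using (Fin; toℕ)
open import Data.Product using (_×_; ∃-syntax)

open import Data.Bool using (Bool; true; false; T)
open import Data.Bool.Properties using (T?; T-≡)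
open import Data.Empty using (⊥; ⊥-elim)
open import Data.Fin using (zero; suc; fromℕ<)
open import Data.Fin.Properties as Fin using (toℕ-fromℕ<; toℕ-injective)
open import Data.Fin.Subset using (Subset; ∣_∣) renaming (_∈_ to _∈ₛ_)
open import Data.Fin.Subset.Properties using (x∈p⇒∣p-x∣<∣p∣; x∈p∧x≢y⇒x∈p-y)
open import Data.List using (List; []; _∷_; [_]; _++_; _ʳ++_; map; length; lookup; head; filter; concatMap)
open import Data.List.Properties using (length-map; length-++; length-ʳ++; filter-all)
open import Data.List.Membership.Propositional using (_∈_; _∉_; find)
open import Data.List.Membership.Propositional.Properties using (∈-map⁻; ∈-∃++; ∈-lookup; ∈-++⁻; ∈-concatMap⁻; ∈-filter⁻)
open import Data.List.Relation.Binary.Disjoint.Propositional using (Disjoint)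
open import Data.List.Relation.Unary.Any using (here; there)
import Data.List.Relation.Unary.All as All
import Data.List.Relation.Unary.All.Properties as All
open import Data.List.Relation.Unary.Linked as Linked using (Linked; []; [-]; _∷_)
open import Data.List.Relation.Unary.Unique.Propositional using (Unique; []; _∷_)
import Data.List.Relation.Unary.Unique.Propositional.Properties as Unique
open import Data.Maybe using (just)
open import Data.Maybe.Relation.Binary.Connected as Connected using (Connected; just; just-nothing)
open import Data.Nat
open import Data.Nat.DivMod using (_%_; _/_; m%n<n; [m+n]%n≡m%n; [m+kn]%n≡m%n; m<n⇒m%n≡m; n%n≡0; %-distribˡ-+; m%n%n≡m%n; m≡m%n+[m/n]*n)
open import Data.Nat.Properties
open import Algebra.Properties.CommutativeMonoid.Sum +-0-commutativeMonoid using (sum; ∑-distrib-+; sum-replicate-zero)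
open import Algebra.Properties.CommutativeSemigroup +-commutativeSemigroup using (interchange)
open import Data.Nat.Tactic.RingSolver using (solve-∀)
open import Data.Product using (_,_; proj₁; proj₂)
open import Data.Sum using (_⊎_; inj₁; inj₂)
open import Data.Vec using ([]; _∷_; tabulate; here; there)
open import Data.Vec.Properties using (lookup∘tabulate; []=⇒lookup; lookup⇒[]=)
open import Function using (_∘_; Equivalence)
open import Relation.Nullary using (¬_; Dec; yes; no; ¬?)
open import Relation.Nullary.Decidable using (⌊_⌋; map′; _⊎-dec_; _×-dec_; toWitness; fromWitness)
open import Relation.Binary.PropositionalEquality hiding ([_])

-- Sums and periodic Boolean sequences

𝟙 : Bool → ℕ
𝟙 true  = 1
𝟙 false = 0

𝟙≤1 : ∀ b → 𝟙 b ≤ 1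
𝟙≤1 true  = ≤-refl
𝟙≤1 false = z≤n

sumTo-cong : ∀ {f h : ℕ → ℕ} r → (∀ t → t < r → f t ≡ h t) → sumTo f r ≡ sumTo h r
sumTo-cong zero    eq = refl
sumTo-cong (suc r) eq = cong₂ _+_ (sumTo-cong r λ t t<r → eq t (m<n⇒m<1+n t<r)) (eq r ≤-refl)

sumTo-+ : ∀ (f h : ℕ → ℕ) r → sumTo (λ t → f t + h t) r ≡ sumTo f r + sumTo h r
sumTo-+ f h zero    = refl
sumTo-+ f h (suc r) rewrite sumTo-+ f h r = interchange (sumTo f r) (sumTo h r) (f r) (h r)

sumTo-* : ∀ c (f : ℕ → ℕ) r → sumTo (λ t → c * f t) r ≡ c * sumTo f r
sumTo-* c f zero    = sym (*-zeroʳ c)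
sumTo-* c f (suc r) rewrite sumTo-* c f r = sym (*-distribˡ-+ c (sumTo f r) (f r))

sumTo-suc : ∀ (f : ℕ → ℕ) r → sumTo f (suc r) ≡ f 0 + sumTo (λ t → f (suc t)) r
sumTo-suc f zero    = +-comm 0 (f 0)
sumTo-suc f (suc r) rewrite sumTo-suc f r = +-assoc (f 0) _ _

sumTo-split : ∀ (f : ℕ → ℕ) a r → sumTo f (a + r) ≡ sumTo f a + sumTo (λ t → f (a + t)) r
sumTo-split f a zero    rewrite +-identityʳ a = sym (+-identityʳ _)
sumTo-split f a (suc r) rewrite +-suc a r | sumTo-split f a r = +-assoc (sumTo f a) _ _

sumTo-≤ : ∀ {f : ℕ → ℕ} {c} r → (∀ t → t < r → f t ≤ c) → sumTo f r ≤ r * c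
sumTo-≤         zero    _   = z≤n
sumTo-≤ {f} {c} (suc r) f≤c = begin
  sumTo f r + f r ≤⟨ +-mono-≤ (sumTo-≤ r λ t t<r → f≤c t (m<n⇒m<1+n t<r)) (f≤c r ≤-refl) ⟩
  r * c + c       ≡⟨ +-comm (r * c) c ⟩
  suc r * c       ∎
  where open ≤-Reasoning

sumTo-≥ : ∀ {f : ℕ → ℕ} {c} r → (∀ t → c ≤ f t) → r * c ≤ sumTo f r
sumTo-≥         zero    _   = z≤n
sumTo-≥ {f} {c} (suc r) c≤f = begin
  suc r * c       ≡⟨ +-comm c (r * c) ⟩
  r * c + c       ≤⟨ +-mono-≤ (sumTo-≥ r c≤f) (c≤f r) ⟩
  sumTo f r + f r ∎
  where open ≤-Reasoning

Periodic : {A : Set} → ℕ → (ℕ → A) → Set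
Periodic q h = ∀ s → h (s + q) ≡ h s

sumTo-periodic : ∀ {f : ℕ → ℕ} {q} → Periodic q f → ∀ b → sumTo (λ t → f (b + t)) q ≡ sumTo f q
sumTo-periodic         per zero    = refl
sumTo-periodic {f} {q} per (suc b) = +-cancelʳ-≡ (f b) _ _ (begin
  sumTo (λ t → f (suc b + t)) q + f b        ≡⟨ +-comm _ (f b) ⟩
  f b + sumTo (λ t → f (suc b + t)) q        ≡⟨ cong₂ _+_ (cong f (+-identityʳ b))
                                                   (sumTo-cong q λ t _ → cong f (+-suc b t)) ⟨
  f (b + 0) + sumTo (λ t → f (b + suc t)) q  ≡⟨ sumTo-suc (λ t → f (b + t)) q ⟨
  sumTo (λ t → f (b + t)) q + f (b + q)      ≡⟨ cong₂ _+_ (sumTo-periodic per b) (per b) ⟩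
  sumTo f q + f b                            ∎)
  where open ≡-Reasoning

count : (ℕ → Bool) → ℕ → ℕ
count h r = sumTo (λ t → 𝟙 (h t)) r

count≤ : ∀ h r → count h r ≤ r
count≤ h r = ≤-trans (sumTo-≤ r λ t _ → 𝟙≤1 (h t)) (≤-reflexive (*-identityʳ r))

count-pos : ∀ h r → 0 < count h r → ∃[ s ] (s < r × T (h s))
count-pos h (suc r) pos with h r in hr
... | true  = r , ≤-refl , subst T (sym hr) _
... | false with count-pos h r (subst (0 <_) (+-identityʳ (count h r)) pos)
...   | s , s<r , hs = s , m<n⇒m<1+n s<r , hs

count-rotate : ∀ {h q} → Periodic q h → ∀ b → count (λ t → h (b + t)) q ≡ count h q
count-rotate per = sumTo-periodic λ s → cong 𝟙 (per s)

𝟙-exclusive : ∀ {a b} → (T a → T b → ⊥) → 𝟙 a + 𝟙 b ≤ 1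
𝟙-exclusive {true}  {true}  excl = ⊥-elim (excl _ _)
𝟙-exclusive {true}  {false} excl = ≤-refl
𝟙-exclusive {false} {b}     excl = 𝟙≤1 b

count-pairs : ∀ h D → (∀ t → t < D → T (h t) → T (h (suc D + t)) → ⊥) → count h (suc D + D) ≤ suc D
count-pairs h D excl = begin
  count h (suc D + D)                                   ≡⟨ sumTo-split f (suc D) D ⟩
  sumTo f D + f D + sumTo (λ t → f (suc D + t)) D       ≡⟨ rearrange (sumTo f D) (f D) _ ⟩
  f D + (sumTo f D + sumTo (λ t → f (suc D + t)) D)     ≡⟨ cong (f D +_) (sumTo-+ f (λ t → f (suc D + t)) D) ⟨
  f D + sumTo (λ t → f t + f (suc D + t)) D             ≤⟨ +-mono-≤ (𝟙≤1 (h D)) (sumTo-≤ D λ t t<D → 𝟙-exclusive (excl t t<D)) ⟩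
  1 + D * 1                                             ≡⟨ cong suc (*-identityʳ D) ⟩
  suc D                                                 ∎
  where
  open ≤-Reasoning
  f = λ t → 𝟙 (h t)
  rearrange : ∀ a b c → a + b + c ≡ b + (a + c)
  rearrange = solve-∀

¬T⇒𝟙≡0 : ∀ {b} → ¬ T b → 𝟙 b ≡ 0
¬T⇒𝟙≡0 {true}  ¬b = ⊥-elim (¬b _)
¬T⇒𝟙≡0 {false} ¬b = refl

count≡0 : ∀ h r → (∀ t → t < r → ¬ T (h t)) → count h r ≡ 0
count≡0 h r none = n≤0⇒n≡0 (≤-trans (sumTo-≤ r λ t t<r → ≤-reflexive (¬T⇒𝟙≡0 (none t t<r)))
                                    (≤-reflexive (*-zeroʳ r)))

Separated : ℕ → ℕ → (ℕ → Bool) → Set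
Separated g q h = ∀ s d → g ≤ d → d + g ≤ q → T (h s) → T (h (s + d)) → ⊥

count-supported : ∀ {q h} → Periodic q h → ∀ b {L} → L ≤ q → (∀ t → L ≤ t → t < q → ¬ T (h (b + t))) →
                  count h q ≡ count (λ t → h (b + t)) L
count-supported {q} {h} per b {L} L≤q outside = begin
  count h q                                ≡⟨ count-rotate per b ⟨
  count h′ q                               ≡⟨ cong (count h′) (m+[n∸m]≡n L≤q) ⟨
  count h′ (L + m)                         ≡⟨ sumTo-split _ L m ⟩
  count h′ L + count (λ t → h′ (L + t)) m  ≡⟨ cong (count h′ L +_) (count≡0 _ m beyond) ⟩
  count h′ L + 0                           ≡⟨ +-identityʳ _ ⟩
  count h′ L                               ∎
  where
  open ≡-Reasoning
  h′ = λ t → h (b + t)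
  m = q ∸ L
  beyond : ∀ t → t < m → ¬ T (h′ (L + t))
  beyond t t<m = outside (L + t) (m≤m+n L t) (≤-trans (≤-reflexive (sym (+-suc L t)))
                                               (≤-trans (+-monoʳ-≤ L t<m) (≤-reflexive (m+[n∸m]≡n L≤q))))

-- Rotate so that a true position sits at D: everything from 2D+1 on is then
-- too far from it, and below that the positions pair up as t, t + (D+1).
count≤-separated : ∀ {D q h} → Periodic q h → suc D + suc D ≤ q → Separated (suc D) q h →
                   count h q ≤ suc D
count≤-separated {D} {q} {h} per 2[1+D]≤q sep with 0 <? count h q
... | no  ¬pos = ≤-trans (≮⇒≥ ¬pos) z≤n
... | yes pos  = around (count-pos h q pos)
  where
  L = suc D + D

  around : ∃[ s ] (s < q × T (h s)) → count h q ≤ suc D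
  around (s₀ , _ , hs₀) = begin
    count h q   ≡⟨ count-supported per b (<⇒≤ L<q) far ⟩
    count h′ L  ≤⟨ count-pairs h′ D paired ⟩
    suc D       ∎
    where
    open ≤-Reasoning
    b = s₀ + q ∸ D
    h′ = λ t → h (b + t)

    L<q : L < q
    L<q = ≤-trans (≤-reflexive (sym (+-suc (suc D) D))) 2[1+D]≤q

    b+D≡s₀+q : b + D ≡ s₀ + q
    b+D≡s₀+q = m∸n+n≡m (≤-trans (≤-trans (m≤n+m D (suc D)) (<⇒≤ L<q)) (m≤n+m q s₀))

    true-at-D : T (h (b + D))
    true-at-D = subst (T ∘ h) (sym b+D≡s₀+q) (subst T (sym (per s₀)) hs₀)

    far : ∀ t → L ≤ t → t < q → ¬ T (h (b + t))
    far t L≤t t<q ht with m≤n⇒∃[o]m+o≡n L≤t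
    ... | c , refl = sep (b + D) (suc D + c) (m≤m+n (suc D) c) (≤-trans (≤-reflexive (regroup D c)) t<q)
                         true-at-D (subst (T ∘ h) (shift b D c) ht)
      where
      shift : ∀ b D c → b + (suc D + D + c) ≡ b + D + (suc D + c)
      shift = solve-∀
      regroup : ∀ D c → suc D + c + suc D ≡ suc (suc D + D + c)
      regroup = solve-∀

    paired : ∀ t → t < D → T (h′ t) → T (h′ (suc D + t)) → ⊥
    paired t _ ht ht′ = sep (b + t) (suc D) ≤-refl 2[1+D]≤q ht (subst (T ∘ h) (shift b D t) ht′)
      where
      shift : ∀ b D t → b + (suc D + t) ≡ b + t + suc D
      shift = solve-∀

count-forced : ∀ {D q h} → Periodic q h → suc D ≤ q → suc D ≤ count h q →
               ∀ b → (∀ t → suc D ≤ t → t < q → ¬ T (h (b + t))) → T (h b)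
count-forced {D} {q} {h} per g≤q g≤count b outside with h b in hb
... | true  = _
... | false = ⊥-elim (<⇒≱ (s≤s count≤D) g≤count)
  where
  rest = count (λ t → h (b + suc t)) D

  count≤D : count h q ≤ D
  count≤D = begin
    count h q                       ≡⟨ count-supported per b g≤q outside ⟩
    count (λ t → h (b + t)) (suc D) ≡⟨ sumTo-suc _ D ⟩
    𝟙 (h (b + 0)) + rest            ≡⟨ cong (λ x → 𝟙 (h x) + rest) (+-identityʳ b) ⟩
    𝟙 (h b) + rest                  ≡⟨ cong (λ x → 𝟙 x + rest) hb ⟩
    rest                            ≤⟨ count≤ _ D ⟩
    D                               ∎
    where open ≤-Reasoning

-- Subsets and lists

∣tabulate∣≡∑𝟙 : ∀ {n} (f : Fin n → Bool) → ∣ tabulate f ∣ ≡ sum (λ i → 𝟙 (f i))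
∣tabulate∣≡∑𝟙 {zero}  f = refl
∣tabulate∣≡∑𝟙 {suc n} f with f zero
... | true  = cong suc (∣tabulate∣≡∑𝟙 (f ∘ suc))
... | false = ∣tabulate∣≡∑𝟙 (f ∘ suc)

sumTo-∑-comm : ∀ {n} (f : Fin n → ℕ → ℕ) r → sumTo (λ s → sum (λ i → f i s)) r ≡ sum (λ i → sumTo (f i) r)
sumTo-∑-comm {n} f zero    = sym (sum-replicate-zero n)
sumTo-∑-comm     f (suc r) = trans (cong (_+ sum (λ i → f i r)) (sumTo-∑-comm f r))
                                    (sym (∑-distrib-+ (λ i → sumTo (f i) r) (λ i → f i r)))

∑≤ : ∀ {n c} (f : Fin n → ℕ) → (∀ i → f i ≤ c) → sum f ≤ n * c
∑≤ {zero}  f f≤c = z≤n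
∑≤ {suc n} f f≤c = +-mono-≤ (f≤c zero) (∑≤ (f ∘ suc) (f≤c ∘ suc))

∑-tight : ∀ {n c} (f : Fin n → ℕ) → (∀ i → f i ≤ c) → n * c ≤ sum f → ∀ i → c ≤ f i
∑-tight {suc n} {c} f f≤c total zero    =
  +-cancelʳ-≤ (n * c) c (f zero) (≤-trans total (+-monoʳ-≤ (f zero) (∑≤ (f ∘ suc) (f≤c ∘ suc))))
∑-tight {suc n} {c} f f≤c total (suc i) =
  ∑-tight (f ∘ suc) (f≤c ∘ suc) (+-cancelˡ-≤ c (n * c) _ (≤-trans total (+-monoˡ-≤ _ (f≤c zero)))) i

∈-tabulate⁺ : ∀ {n} {f : Fin n → Bool} {x} → T (f x) → x ∈ₛ tabulate f
∈-tabulate⁺ {f = f} {x} fx = lookup⇒[]= x (tabulate f) (trans (lookup∘tabulate f x) (Equivalence.to T-≡ fx))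

∈-tabulate⁻ : ∀ {n} {f : Fin n → Bool} {x} → x ∈ₛ tabulate f → T (f x)
∈-tabulate⁻ {f = f} {x} x∈ = Equivalence.from T-≡ (trans (sym (lookup∘tabulate f x)) ([]=⇒lookup x∈))

length≤∣∣ : ∀ {n} {p : Subset n} {xs} → Unique xs → (∀ {x} → x ∈ xs → x ∈ₛ p) → length xs ≤ ∣ p ∣
length≤∣∣ []                 _    = z≤n
length≤∣∣ {p = p} (x≢ ∷ uniq) ⊆p =
  ≤-trans (s≤s (length≤∣∣ uniq λ y∈ → x∈p∧x≢y⇒x∈p-y (⊆p (there y∈)) (≢-sym (All.lookup x≢ y∈))))
          (x∈p⇒∣p-x∣<∣p∣ (⊆p (here refl)))

length≤1+length-filter≢ : ∀ {n} (p : Fin n) {xs} → Unique xs →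
                          length xs ≤ suc (length (filter (λ y → ¬? (y Fin.≟ p)) xs))
length≤1+length-filter≢ p {[]}     []          = z≤n
length≤1+length-filter≢ p {x ∷ xs} (x≢ ∷ uniq) with x Fin.≟ p
... | yes refl rewrite filter-all (λ y → ¬? (y Fin.≟ p)) (All.map ≢-sym x≢) = ≤-refl
... | no  _    = s≤s (length≤1+length-filter≢ p uniq)

elements : ∀ {n} → Subset n → List (Fin n)
elements []           = []
elements (true  ∷ p)  = zero ∷ map suc (elements p)
elements (false ∷ p)  = map suc (elements p)

length-elements : ∀ {n} (p : Subset n) → length (elements p) ≡ ∣ p ∣
length-elements []          = refl
length-elements (true  ∷ p) = cong suc (trans (length-map suc (elements p)) (length-elements p))
length-elements (false ∷ p) = trans (length-map suc (elements p)) (length-elements p)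

elements-unique : ∀ {n} (p : Subset n) → Unique (elements p)
elements-unique []          = []
elements-unique (true  ∷ p) = All.map⁺ (All.universal (λ _ ()) _) ∷ Unique.map⁺ Fin.suc-injective (elements-unique p)
elements-unique (false ∷ p) = Unique.map⁺ Fin.suc-injective (elements-unique p)

∈-elements : ∀ {n} (p : Subset n) {x} → x ∈ elements p → x ∈ₛ p
∈-elements (true  ∷ p) (here refl) = here
∈-elements (true  ∷ p) (there x∈)  with ∈-map⁻ suc x∈
... | y , y∈ , refl = there (∈-elements p y∈)
∈-elements (false ∷ p) x∈          with ∈-map⁻ suc x∈
... | y , y∈ , refl = there (∈-elements p y∈)

module _ {A : Set} where

  Unique-++⁻ : ∀ (as : List A) {bs} → Unique (as ++ bs) → Unique as × Disjoint as bs
  Unique-++⁻ []       uniq        = [] , λ ()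
  Unique-++⁻ (a ∷ as) (a≢ ∷ uniq) with Unique-++⁻ as uniq
  ... | uniq-as , dis = All.++⁻ˡ as a≢ ∷ uniq-as , λ where
    (here refl , b∈) → All.lookup (All.++⁻ʳ as a≢) b∈ refl
    (there a∈  , b∈) → dis (a∈ , b∈)

  Unique-ʳ++⁻ : ∀ (as : List A) {bs} → Unique (as ʳ++ bs) → Unique bs × Disjoint as bs
  Unique-ʳ++⁻ []       uniq = uniq , λ ()
  Unique-ʳ++⁻ (a ∷ as) uniq with Unique-ʳ++⁻ as uniq
  ... | a≢ ∷ uniq-bs , dis = uniq-bs , λ where
    (here refl , b∈) → All.lookup a≢ b∈ refl
    (there a∈  , b∈) → dis (a∈ , there b∈)

  lookup-injective : ∀ {xs : List A} → Unique xs → ∀ {i j} → lookup xs i ≡ lookup xs j → i ≡ j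
  lookup-injective (x≢ ∷ uniq) {zero}  {zero}  eq = refl
  lookup-injective (x≢ ∷ uniq) {zero}  {suc j} eq = ⊥-elim (All.lookup x≢ (∈-lookup j) eq)
  lookup-injective (x≢ ∷ uniq) {suc i} {zero}  eq = ⊥-elim (All.lookup x≢ (∈-lookup i) (sym eq))
  lookup-injective (x≢ ∷ uniq) {suc i} {suc j} eq = cong suc (lookup-injective uniq eq)

  concatMap-unique : ∀ {B : Set} {f : A → List B} {ys} → Unique ys → (∀ {y} → y ∈ ys → Unique (f y)) →
                     (∀ {y y′} → y ∈ ys → y′ ∈ ys → y ≢ y′ → Disjoint (f y) (f y′)) →
                     Unique (concatMap f ys)
  concatMap-unique []          _    _   = []
  concatMap-unique {f = f} (y≢ ∷ uniq) each dis =
    Unique.++⁺ (each (here refl)) (concatMap-unique uniq (each ∘ there) λ y∈ y′∈ → dis (there y∈) (there y′∈))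
      λ (z∈ , z∈rest) → let y′ , y′∈ , z∈′ = find (∈-concatMap⁻ f z∈rest) in
        dis (here refl) (there y′∈) (All.lookup y≢ y′∈) (z∈ , z∈′)

  length-concatMap-≥ : ∀ {B : Set} {f : A → List B} {m} ys → (∀ {y} → y ∈ ys → m ≤ length (f y)) →
                       length ys * m ≤ length (concatMap f ys)
  length-concatMap-≥         []       _     = z≤n
  length-concatMap-≥ {f = f} (y ∷ ys) m≤f = ≤-trans
    (+-mono-≤ (m≤f (here refl)) (length-concatMap-≥ ys (m≤f ∘ there)))
    (≤-reflexive (sym (length-++ (f y))))

module _ {A : Set} {R : A → A → Set} where

  Linked-lookup : ∀ xs {ys} → Linked R (xs ++ ys) → ∀ i j → suc (toℕ i) ≡ toℕ j → R (lookup xs i) (lookup xs j)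
  Linked-lookup (x ∷ y ∷ xs) (r ∷ _)     zero    (suc zero) _  = r
  Linked-lookup (x ∷ y ∷ xs) (_ ∷ links) (suc i) (suc j)    eq = Linked-lookup (y ∷ xs) links i j (suc-injective eq)

  Linked-lookup-last : ∀ xs {y ys} → Linked R (xs ++ y ∷ ys) → ∀ i → suc (toℕ i) ≡ length xs → R (lookup xs i) y
  Linked-lookup-last (x ∷ [])     (r ∷ _)     zero    _  = r
  Linked-lookup-last (x ∷ y ∷ xs) (_ ∷ links) (suc i) eq = Linked-lookup-last (y ∷ xs) links i (suc-injective eq)

-- Non-backtracking walks and Moore trees

module _ {A : Set} where

  data NonBacktracking : List A → Set where
    []  : NonBacktracking []
    [-] : ∀ {x} → NonBacktracking [ x ]
    _∷_ : ∀ {x y xs} → Connected _≢_ (just x) (head xs) → NonBacktracking (y ∷ xs) →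
          NonBacktracking (x ∷ y ∷ xs)

  NonBacktracking-tail : ∀ {x xs} → NonBacktracking (x ∷ xs) → NonBacktracking xs
  NonBacktracking-tail [-]      = []
  NonBacktracking-tail (_ ∷ nb) = nb

  -- The last hypothesis says that x ∷ as and x ∷ acc leave x towards different vertices.
  NonBacktracking-ʳ++ : ∀ {x} as {acc} → NonBacktracking (x ∷ as) → NonBacktracking (x ∷ acc) →
                        Connected _≢_ (head as) (head acc) → NonBacktracking (as ʳ++ x ∷ acc)
  NonBacktracking-ʳ++ []       _         nb-acc _ = nb-acc
  NonBacktracking-ʳ++ (a ∷ as) (x≢ ∷ nb) nb-acc a≢ = NonBacktracking-ʳ++ as nb (a≢ ∷ nb-acc) (Connected.sym ≢-sym x≢)

module _ (G : Graph) where

  E-sym : ∀ {x y} → E G x y → E G y x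
  E-sym {x} {y} = subst T (Graph.sym G x y)

  E-irrefl : ∀ {x} → ¬ E G x x
  E-irrefl {x} = subst T (Graph.irref G x)

module _ {G : Graph} where

  _++ʷ_ : ∀ {x y z a b} → Walk G x y a → Walk G y z b → Walk G x z (a + b)
  nil      ++ʷ W = W
  cons e V ++ʷ W = cons e (V ++ʷ W)

  snocʷ : ∀ {x y z a} → Walk G x y a → E G y z → Walk G x z (suc a)
  snocʷ {a = a} W e = subst (Walk G _ _) (+-comm a 1) (W ++ʷ cons e nil)

  reverseʷ : ∀ {x y a} → Walk G x y a → Walk G y x a
  reverseʷ nil        = nil
  reverseʷ (cons e W) = snocʷ (reverseʷ W) (E-sym G e)

  unsnocʷ : ∀ {x y l} → Walk G x y (suc l) → ∃[ w ] (Walk G x w l × E G w y)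
  unsnocʷ (cons e nil)         = _ , nil , e
  unsnocʷ (cons e (cons e′ W)) with unsnocʷ (cons e′ W)
  ... | w , W′ , e″ = w , cons e W′ , e″

  Ball-suc : ∀ {t x z} → Ball G (suc t) x z → Ball G t x z ⊎ ∃[ y ] (E G x y × Ball G t y z)
  Ball-suc (zero  , _       , nil)      = inj₁ (0 , z≤n , nil)
  Ball-suc (suc l , s≤s l≤t , cons e W) = inj₂ (_ , e , l , l≤t , W)

  Ball-mono : ∀ {t t′ x z} → t ≤ t′ → Ball G t x z → Ball G t′ x z
  Ball-mono t≤t′ (l , l≤t , W) = l , ≤-trans l≤t t≤t′ , W

  Linked⇒Ball : ∀ {x ws z} → Linked (E G) (x ∷ ws) → z ∈ x ∷ ws → Ball G (length ws) x z
  Linked⇒Ball                 _           (here refl) = 0 , z≤n , nil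
  Linked⇒Ball {ws = _ ∷ _}   (e ∷ links) (there z∈)  with Linked⇒Ball links z∈
  ... | l , l≤ , W = suc l , s≤s l≤ , cons e W

module _ (G : Graph) where
  open Graph G using (n; adj)

  ball? : ∀ t x z → Dec (Ball G t x z)
  ball? zero    x z = map′ (λ { refl → 0 , z≤n , nil }) (λ { (0 , _ , nil) → refl }) (x Fin.≟ z)
  ball? (suc t) x z = map′ grow Ball-suc (ball? t x z ⊎-dec Fin.any? (λ y → T? (adj x y) ×-dec ball? t y z))
    where
    grow : Ball G t x z ⊎ ∃[ y ] (E G x y × Ball G t y z) → Ball G (suc t) x z
    grow (inj₁ (l , l≤t , W))         = l , m≤n⇒m≤1+n l≤t , W
    grow (inj₂ (_ , e , l , l≤t , W)) = suc l , s≤s l≤t , cons e W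

  Linked-ʳ++ : ∀ {x} as {acc} → Linked (E G) (x ∷ as) → Linked (E G) (x ∷ acc) → Linked (E G) (as ʳ++ x ∷ acc)
  Linked-ʳ++ []       _         links-acc = links-acc
  Linked-ʳ++ (a ∷ as) (e ∷ links) links-acc = Linked-ʳ++ as links (E-sym G e ∷ links-acc)

  closedWalk⇒IsCycle : ∀ x seg {rest} → 2 ≤ length seg → Unique (x ∷ seg) → Linked (E G) (x ∷ seg ++ x ∷ rest) →
                       IsCycle G (length (x ∷ seg)) (lookup (x ∷ seg))
  closedWalk⇒IsCycle x seg 2≤len uniq links = record
    { len≥3 = s≤s 2≤len
    ; inj   = lookup-injective uniq
    ; edges = edges
    }
    where
    edges : ∀ i j → suc (toℕ i) ≡ toℕ j ⊎ (suc (toℕ i) ≡ length (x ∷ seg) × toℕ j ≡ 0) →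
            E G (lookup (x ∷ seg) i) (lookup (x ∷ seg) j)
    edges i j       (inj₁ eq)       = Linked-lookup (x ∷ seg) links i j eq
    edges i zero    (inj₂ (eq , _)) = Linked-lookup-last (x ∷ seg) links i eq

  module Girth (g : ℕ) (girth : ∀ l c → IsCycle G l c → g ≤ l) where

    -- The first return of a non-backtracking walk to its start closes a cycle,
    -- which is shorter than the walk.
    nonBacktracking-unique : ∀ {xs} → NonBacktracking xs → Linked (E G) xs → length xs ≤ g → Unique xs
    nonBacktracking-unique {[]}     _  _     _   = []
    nonBacktracking-unique {x ∷ xs} nb links len = All.¬Any⇒All¬ xs no-return ∷ uniq
      where
      uniq : Unique xs
      uniq = nonBacktracking-unique (NonBacktracking-tail nb) (Linked.tail links) (≤-trans (n≤1+n _) len)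

      closed : ∀ seg {rest} → NonBacktracking (x ∷ seg ++ x ∷ rest) → Linked (E G) (x ∷ seg ++ x ∷ rest) →
               length (x ∷ seg ++ x ∷ rest) ≤ g → Unique (x ∷ seg) → ⊥
      closed []              _                 (e ∷ _) _   _    = E-irrefl G e
      closed (_ ∷ [])        (just x≢x ∷ _)    _       _   _    = x≢x refl
      closed seg@(_ ∷ _ ∷ _) {rest} _          links   len uniq =
        <⇒≱ (≤-trans shorter len) (girth _ _ (closedWalk⇒IsCycle x seg (s≤s (s≤s z≤n)) uniq links))
        where
        shorter : length (x ∷ seg) < length (x ∷ seg ++ x ∷ rest)
        shorter = s≤s (≤-trans (m<m+n (length seg) z<s) (≤-reflexive (sym (length-++ seg))))

      no-return : x ∉ xs
      no-return x∈ with ∈-∃++ x∈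
      ... | seg , rest , refl with Unique-++⁻ seg uniq
      ...   | uniq-seg , dis = closed seg nb links len (All.¬Any⇒All¬ seg (λ x∈seg → dis (x∈seg , here refl)) ∷ uniq-seg)

    neighbours : V G → List (V G)
    neighbours x = elements (tabulate (adj x))

    children : V G → V G → List (V G)
    children p x = filter (λ y → ¬? (y Fin.≟ p)) (neighbours x)

    ∈-neighbours : ∀ {x y} → y ∈ neighbours x → E G x y
    ∈-neighbours y∈ = ∈-tabulate⁻ (∈-elements _ y∈)

    ∈-children : ∀ {p x y} → y ∈ children p x → E G x y × y ≢ p
    ∈-children y∈ with ∈-filter⁻ (λ y → ¬? (y Fin.≟ _)) y∈
    ... | y∈′ , y≢p = ∈-neighbours y∈′ , y≢p

    children-unique : ∀ p x → Unique (children p x)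
    children-unique p x = Unique.filter⁺ (λ y → ¬? (y Fin.≟ p)) (elements-unique (tabulate (adj x)))

    children-root : ∀ x → children x x ≡ neighbours x
    children-root x = filter-all (λ y → ¬? (y Fin.≟ x)) (All.tabulate λ y∈ → λ { refl → E-irrefl G (∈-neighbours y∈) })

    degree≤1+children : ∀ p x → degree G x ≤ suc (length (children p x))
    degree≤1+children p x = ≤-trans (≤-reflexive (sym (length-elements (tabulate (adj x)))))
                                    (length≤1+length-filter≢ p (elements-unique (tabulate (adj x))))

    branch : V G → V G → ℕ → List (V G)
    branch p x zero    = [ x ]
    branch p x (suc t) = x ∷ concatMap (λ y → branch x y t) (children p x)

    Reach : V G → V G → ℕ → V G → Set
    Reach p x t z = ∃[ ws ] (NonBacktracking (p ∷ x ∷ ws) × Linked (E G) (x ∷ ws) × length ws ≤ t × z ∈ x ∷ ws)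

    Reach-here : ∀ {p x t} → Reach p x t x
    Reach-here = [] , just-nothing ∷ [-] , [-] , z≤n , here refl

    Reach-step : ∀ {p x y t z} → E G x y → y ≢ p → Reach x y t z → Reach p x (suc t) z
    Reach-step e y≢p (ws , nb , links , len , z∈) = _ ∷ ws , just (≢-sym y≢p) ∷ nb , e ∷ links , s≤s len , there z∈

    branch-Reach : ∀ {p x} t {z} → z ∈ branch p x t → Reach p x t z
    branch-Reach zero    (here refl) = Reach-here
    branch-Reach (suc t) (here refl) = Reach-here
    branch-Reach (suc t) (there z∈)  with find (∈-concatMap⁻ _ z∈)
    ... | y , y∈ , z∈′ = Reach-step (proj₁ (∈-children y∈)) (proj₂ (∈-children y∈)) (branch-Reach t z∈′)

    branch⊆Ball : ∀ {p x} t {z} → z ∈ branch p x t → Ball G t x z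
    branch⊆Ball t z∈ with branch-Reach t z∈
    ... | _ , _ , links , len , z∈′ = Ball-mono len (Linked⇒Ball links z∈′)

    -- Two walks leaving the edge xy in opposite directions and meeting again
    -- would combine into a short non-backtracking walk that revisits a vertex.
    no-meeting : ∀ {x y t₁ t₂ z} → E G x y → Reach y x t₁ z → Reach x y t₂ z → t₁ + suc t₂ < g → ⊥
    no-meeting {x} {y} {t₁} {t₂} e (ws₁ , nb₁@(y≢ ∷ _) , links₁ , len₁ , z∈₁) (ws₂ , nb₂ , links₂ , len₂ , z∈₂) short
      with Unique-ʳ++⁻ ws₁ (nonBacktracking-unique
             (NonBacktracking-ʳ++ ws₁ (NonBacktracking-tail nb₁) nb₂ (Connected.sym ≢-sym y≢))
             (Linked-ʳ++ ws₁ links₁ (e ∷ links₂))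
             length≤g)
      where
      length≤g : length (ws₁ ʳ++ x ∷ y ∷ ws₂) ≤ g
      length≤g = begin
        length (ws₁ ʳ++ x ∷ y ∷ ws₂)        ≡⟨ length-ʳ++ ws₁ ⟩
        length ws₁ + suc (suc (length ws₂)) ≤⟨ +-mono-≤ len₁ (s≤s (s≤s len₂)) ⟩
        t₁ + suc (suc t₂)                   ≡⟨ +-suc t₁ (suc t₂) ⟩
        suc (t₁ + suc t₂)                   ≤⟨ short ⟩
        g                                   ∎
        where open ≤-Reasoning
    ... | x≢ ∷ _ , dis with z∈₁
    ...   | here refl = All.lookup x≢ z∈₂ refl
    ...   | there z∈  = dis (z∈ , there z∈₂)

    branch-unique : ∀ p x t → t + t < g → Unique (branch p x t)
    branch-unique p x zero    _     = All.[] ∷ []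
    branch-unique p x (suc t) short =
      All.¬Any⇒All¬ _ x-not-below ∷ concatMap-unique (children-unique p x) (λ _ → branch-unique x _ t short′) disjoint
      where
      short′ : t + t < g
      short′ = ≤-<-trans (+-mono-≤ (n≤1+n t) (n≤1+n t)) short
      x-not-below : x ∉ concatMap (λ y → branch x y t) (children p x)
      x-not-below x∈ with find (∈-concatMap⁻ _ x∈)
      ... | y , y∈ , x∈′ = no-meeting (proj₁ (∈-children y∈)) (Reach-here {t = 0}) (branch-Reach t x∈′)
                                         (≤-trans (s≤s (s≤s (m≤m+n t (suc t)))) short)
      disjoint : ∀ {y y′} → y ∈ children p x → y′ ∈ children p x → y ≢ y′ → Disjoint (branch x y t) (branch x y′ t)
      disjoint y∈ y′∈ y≢y′ (z∈ , z∈′) =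
        no-meeting (proj₁ (∈-children y∈)) (Reach-step (proj₁ (∈-children y′∈)) (≢-sym y≢y′) (branch-Reach t z∈′))
                   (branch-Reach t z∈) short

    module _ (δ : ℕ) (δ≤degree : ∀ x → δ ≤ degree G x) where

      private
        β = δ ∸ 1

      geometric : ℕ → ℕ
      geometric r = sumTo (β ^_) r

      geometric-suc : ∀ r → geometric (suc r) ≡ 1 + β * geometric r
      geometric-suc r = trans (sumTo-suc (β ^_) r) (cong (1 +_) (sumTo-* β (β ^_) r))

      branch-length : ∀ p x t → geometric (suc t) ≤ length (branch p x t)
      branch-length p x zero    = ≤-refl
      branch-length p x (suc t) = begin
        geometric (suc (suc t))                          ≡⟨ geometric-suc (suc t) ⟩
        1 + β * geometric (suc t)                        ≤⟨ s≤s (*-monoˡ-≤ _ β≤children) ⟩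
        1 + length (children p x) * geometric (suc t)    ≤⟨ s≤s (length-concatMap-≥ {f = λ y → branch x y t} (children p x) λ _ → branch-length x _ t) ⟩
        length (branch p x (suc t))                      ∎
        where
        open ≤-Reasoning
        β≤children : β ≤ length (children p x)
        β≤children = ∸-monoˡ-≤ 1 (≤-trans (δ≤degree x) (degree≤1+children p x))

      root-length : ∀ x t → 1 + δ * geometric t ≤ length (branch x x t)
      root-length x zero    rewrite *-zeroʳ δ = ≤-refl
      root-length x (suc t) = s≤s (begin
        δ * geometric (suc t)                             ≤⟨ *-monoˡ-≤ _ δ≤children ⟩
        length (children x x) * geometric (suc t)         ≤⟨ length-concatMap-≥ {f = λ y → branch x y t} (children x x) (λ _ → branch-length x _ t) ⟩
        length (concatMap (λ y → branch x y t) (children x x)) ∎)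
        where
        open ≤-Reasoning
        δ≤children : δ ≤ length (children x x)
        δ≤children = ≤-trans (δ≤degree x)
                       (≤-reflexive (trans (sym (length-elements (tabulate (adj x)))) (cong length (sym (children-root x)))))

      moore-odd : ∀ {k x} (P : Subset n) → k + k < g → (∀ {z} → Ball G k x z → z ∈ₛ P) →
                  1 + sumTo (λ i → δ * β ^ i) k ≤ ∣ P ∣
      moore-odd {k} {x} P short ball⊆P = begin
        1 + sumTo (λ i → δ * β ^ i) k ≡⟨ cong suc (sumTo-* δ (β ^_) k) ⟩
        1 + δ * geometric k           ≤⟨ root-length x k ⟩
        length (branch x x k)         ≤⟨ length≤∣∣ (branch-unique x x k short) (ball⊆P ∘ branch⊆Ball k) ⟩
        ∣ P ∣                         ∎
        where open ≤-Reasoning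

      moore-even : ∀ {k x y} (P : Subset n) → k + suc k < g → E G x y →
                   (∀ {z} → Ball G k x z → z ∈ₛ P) → (∀ {z} → Ball G k y z → z ∈ₛ P) →
                   2 + sumTo (λ i → 2 * β ^ suc i) k ≤ ∣ P ∣
      moore-even {k} {x} {y} P short e ball-x⊆P ball-y⊆P = begin
        2 + sumTo (λ i → 2 * β ^ suc i) k               ≡⟨ two-halves ⟩
        geometric (suc k) + geometric (suc k)           ≤⟨ +-mono-≤ (branch-length y x k) (branch-length x y k) ⟩
        length (branch y x k) + length (branch x y k)   ≡⟨ length-++ (branch y x k) ⟨
        length (branch y x k ++ branch x y k)           ≤⟨ length≤∣∣ uniq ⊆P ⟩
        ∣ P ∣                                           ∎
        where
        open ≤-Reasoning
        two-halves : 2 + sumTo (λ i → 2 * β ^ suc i) k ≡ geometric (suc k) + geometric (suc k)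
        two-halves rewrite sumTo-* 2 (λ i → β ^ suc i) k | sumTo-suc (β ^_) k = double (sumTo (λ i → β ^ suc i) k)
          where
          double : ∀ s → 2 + 2 * s ≡ 1 + s + (1 + s)
          double = solve-∀
        short′ : k + k < g
        short′ = ≤-<-trans (+-monoʳ-≤ k (n≤1+n k)) short
        uniq : Unique (branch y x k ++ branch x y k)
        uniq = Unique.++⁺ (branch-unique y x k short′) (branch-unique x y k short′)
                 λ (z∈₁ , z∈₂) → no-meeting e (branch-Reach k z∈₁) (branch-Reach k z∈₂) short
        ⊆P : ∀ {z} → z ∈ branch y x k ++ branch x y k → z ∈ₛ P
        ⊆P z∈ with ∈-++⁻ (branch y x k) z∈
        ... | inj₁ z∈₁ = ball-x⊆P (branch⊆Ball k z∈₁)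
        ... | inj₂ z∈₂ = ball-y⊆P (branch⊆Ball k z∈₂)

-- Isometric loops and their windows

record IsIsometricLoop (G : Graph) (q : ℕ) (v : ℕ → V G) : Set where
  field
    periodic  : Periodic q v
    step      : ∀ s → E G (v s) (v (suc s))
    isometric : ∀ a s l → s < q → Walk G (v a) (v (a + s)) l → s ⊓ (q ∸ s) ≤ l

module Loop {G : Graph} {q : ℕ} {v : ℕ → V G} (loop : IsIsometricLoop G q v) where
  open IsIsometricLoop loop

  periodic-* : ∀ s m → v (s + m * q) ≡ v s
  periodic-* s zero    = cong v (+-identityʳ s)
  periodic-* s (suc m) = trans (cong v (sym (+-assoc s q (m * q)))) (trans (periodic-* (s + q) m) (periodic s))

  far-apart : ∀ {D₁ D₂ a s w} → Ball G D₁ (v a) w → Ball G D₂ (v (a + s)) w →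
              D₁ + D₂ < s → D₁ + D₂ + s < q → ⊥
  far-apart {D₁} {D₂} {a} {s} (l₁ , l₁≤ , W₁) (l₂ , l₂≤ , W₂) near far =
    <⇒≱ (s≤s (+-mono-≤ l₁≤ l₂≤)) (≤-trans (⊓-glb near (m+n≤o⇒m≤o∸n _ far))
                                         (isometric a s _ s<q (W₁ ++ʷ reverseʷ W₂)))
    where
    s<q : s < q
    s<q = ≤-trans (s≤s (m≤n+m s (D₁ + D₂))) far

module Windows {G : Graph} {q v} (loop : IsIsometricLoop G q v) (k e : ℕ) (e≤1 : e ≤ 1) (q-big : 6 * k + 3 < q) where
  open IsIsometricLoop loop
  open Loop loop

  K g : ℕ
  K = k + k
  g = suc (K + e)

  -- For odd g (e = 0) the window is the ball D_k(v s); for even g it is the union of the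
  -- balls around the edge v s, v (s + 1).
  Window : ℕ → V G → Set
  Window s w = Ball G k (v s) w ⊎ Ball G k (v (s + e)) w

  window? : ∀ s w → Dec (Window s w)
  window? s w = ball? G k (v s) w ⊎-dec ball? G k (v (s + e)) w

  inWindow : V G → ℕ → Bool
  inWindow w s = ⌊ window? s w ⌋

  windowSet : ℕ → Subset (Graph.n G)
  windowSet s = tabulate (λ w → inWindow w s)

  inWindow-periodic : ∀ w → Periodic q (inWindow w)
  inWindow-periodic w s = cong₂ (λ x y → ⌊ ball? G k x w ⊎-dec ball? G k y w ⌋)
                                (periodic s) (trans (cong v (swap s q e)) (periodic (s + e)))
    where
    swap : ∀ s q e → s + q + e ≡ s + e + q
    swap = solve-∀

  Window⇒Ball : ∀ {s w} → Window s w → ∃[ j ] (j ≤ e × Ball G k (v (s + j)) w)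
  Window⇒Ball {s} (inj₁ near) = 0 , z≤n , subst (λ x → Ball G k (v x) _) (sym (+-identityʳ s)) near
  Window⇒Ball     (inj₂ near) = e , ≤-refl , near

  far-apart-offsets : ∀ {a i j w} → Ball G k (v (a + i)) w → Ball G k (v (a + j)) w →
                      i + K < j → j + K < q + i → ⊥
  far-apart-offsets {a} {i} {j} {w} near₁ near₂ i+K<j j+K<q+i =
    far-apart near₁ near₂′ (+-cancelˡ-< i K s (subst (i + K <_) (sym i+s≡j) i+K<j)) (+-cancelˡ-< i (K + s) q i+[K+s]<i+q)
    where
    s = j ∸ i
    i+s≡j : i + s ≡ j
    i+s≡j = m+[n∸m]≡n (≤-trans (m≤m+n i K) (<⇒≤ i+K<j))
    near₂′ : Ball G k (v (a + i + s)) w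
    near₂′ = subst (λ x → Ball G k (v x) w) (sym (trans (+-assoc a i s) (cong (a +_) i+s≡j))) near₂
    i+[K+s]<i+q : i + (K + s) < i + q
    i+[K+s]<i+q = begin-strict
      i + (K + s) ≡⟨ regroup i K s ⟩
      i + s + K   ≡⟨ cong (_+ K) i+s≡j ⟩
      j + K       <⟨ j+K<q+i ⟩
      q + i       ≡⟨ +-comm q i ⟩
      i + q       ∎
      where
      open ≤-Reasoning
      regroup : ∀ i K s → i + (K + s) ≡ i + s + K
      regroup = solve-∀

  window-separated : ∀ {w s d} → g ≤ d → d + g ≤ q → Window s w → Window (s + d) w → ⊥
  window-separated {w} {s} {d} g≤d d+g≤q win₁ win₂ with Window⇒Ball win₁ | Window⇒Ball win₂
  ... | j₁ , j₁≤e , near₁ | j₂ , j₂≤e , near₂ =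
    far-apart-offsets {a = s} near₁ (subst (λ x → Ball G k (v x) w) (+-assoc s d j₂) near₂) left right
    where
    j+K≤K+e : ∀ {j} → j ≤ e → j + K ≤ K + e
    j+K≤K+e {j} j≤e = ≤-trans (≤-reflexive (+-comm j K)) (+-monoʳ-≤ K j≤e)
    left : j₁ + K < d + j₂
    left = ≤-trans (s≤s (j+K≤K+e j₁≤e)) (≤-trans g≤d (m≤m+n d j₂))
    right : d + j₂ + K < q + j₁
    right = begin-strict
      d + j₂ + K   ≡⟨ +-assoc d j₂ K ⟩
      d + (j₂ + K) ≤⟨ +-monoʳ-≤ d (j+K≤K+e j₂≤e) ⟩
      d + (K + e)  <⟨ ≤-reflexive (sym (+-suc d (K + e))) ⟩
      d + g        ≤⟨ d+g≤q ⟩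
      q            ≤⟨ m≤m+n q j₁ ⟩
      q + j₁       ∎
      where open ≤-Reasoning

  g+g≤q : g + g ≤ q
  g+g≤q = begin
    g + g                   ≤⟨ +-mono-≤ g≤K+2 g≤K+2 ⟩
    suc (suc K) + suc (suc K) ≤⟨ m≤m+n _ K ⟩
    suc (suc K) + suc (suc K) + K ≡⟨ six k ⟩
    suc (6 * k + 3)         ≤⟨ q-big ⟩
    q                       ∎
    where
    open ≤-Reasoning
    g≤K+2 : g ≤ suc (suc K)
    g≤K+2 = s≤s (≤-trans (+-monoʳ-≤ K e≤1) (≤-reflexive (+-comm K 1)))
    six : ∀ k → suc (suc (k + k)) + suc (suc (k + k)) + (k + k) ≡ suc (6 * k + 3)
    six = solve-∀

  occurrences≤g : ∀ w → count (inWindow w) q ≤ g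
  occurrences≤g w = count≤-separated (inWindow-periodic w) g+g≤q
    λ s d g≤d d+g≤q in₁ in₂ → window-separated g≤d d+g≤q (toWitness in₁) (toWitness in₂)

  -- Far-off vertices of the loop are excluded through w′ itself, the nearer ones
  -- through w, which is within k of v a and within k + 1 of them.
  beyond-lens : ∀ {a w w′} → Ball G k (v a) w → Ball G k (v (suc a + K)) w′ → E G w′ w →
                ∀ r → 0 < r → r + K < q → ¬ Ball G k (v (suc a + K + r)) w′
  beyond-lens {a} {w} {w′} near-a near-end e′ r 0<r r+K<q near-r with K <? r
  ... | yes K<r = far-apart near-end near-r K<r (subst (_< q) (+-comm r K) r+K<q)
  ... | no  r≮K = far-apart {D₂ = suc k} near-a near-r′ (subst (_< suc K + r) (sym (+-suc k k)) (m<m+n (suc K) 0<r)) far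
    where
    r≤K : r ≤ K
    r≤K = ≮⇒≥ r≮K
    near-r′ : Ball G (suc k) (v (a + (suc K + r))) w
    near-r′ = let l , l≤k , W = near-r in
      suc l , s≤s l≤k , subst (λ x → Walk G (v x) w (suc l)) (shift a K r) (snocʷ W e′)
      where
      shift : ∀ a K r → suc a + K + r ≡ a + (suc K + r)
      shift = solve-∀
    far : k + suc k + (suc K + r) < q
    far = begin-strict
      k + suc k + (suc K + r) ≤⟨ +-monoʳ-≤ (k + suc k) (+-monoʳ-≤ (suc K) r≤K) ⟩
      k + suc k + (suc K + K) <⟨ ≤-reflexive (collect k) ⟩
      6 * k + 3               <⟨ q-big ⟩
      q                       ∎
      where
      open ≤-Reasoning
      collect : ∀ k → suc (k + suc k + (suc (k + k) + (k + k))) ≡ 6 * k + 3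
      collect = solve-∀

  windows-beyond-lens : ∀ {a w w′ b} → Ball G k (v a) w → Ball G k (v (suc a + K)) w′ → E G w′ w → b + e ≡ suc a →
                        ∀ t → g ≤ t → t < q → ¬ Window (b + t) w′
  windows-beyond-lens {a} {w} {w′} {b} near-a near-end e′ b+e≡1+a t g≤t t<q win
    with Window⇒Ball win | m≤n⇒∃[o]m+o≡n g≤t
  ... | j , j≤e , near | c , refl =
    beyond-lens near-a near-end e′ (suc (c + j)) (s≤s z≤n) in-range
      (subst (λ x → Ball G k (v x) w′) (trans (shift b e K c j) (cong (λ x → x + K + suc (c + j)) b+e≡1+a)) near)
    where
    shift : ∀ b e K c j → b + (suc (K + e) + c) + j ≡ b + e + K + suc (c + j)
    shift = solve-∀
    in-range : suc (c + j) + K < q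
    in-range = begin-strict
      suc (c + j + K)   ≤⟨ s≤s (+-monoˡ-≤ K (+-monoʳ-≤ c j≤e)) ⟩
      suc (c + e + K)   ≡⟨ cong suc (rotate c e K) ⟩
      suc (K + e) + c   <⟨ t<q ⟩
      q                 ∎
      where
      open ≤-Reasoning
      rotate : ∀ c e K → c + e + K ≡ K + e + c
      rotate = solve-∀

  module Tight (covered : Graph.n G * g ≤ sumTo (λ s → ∣ windowSet s ∣) q) where

    g≤occurrences : ∀ w → g ≤ count (inWindow w) q
    g≤occurrences = ∑-tight (λ w → count (inWindow w) q) occurrences≤g (begin
      Graph.n G * g                                 ≤⟨ covered ⟩
      sumTo (λ s → ∣ windowSet s ∣) q               ≡⟨ sumTo-cong q (λ s _ → ∣tabulate∣≡∑𝟙 (λ w → inWindow w s)) ⟩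
      sumTo (λ s → sum (λ w → 𝟙 (inWindow w s))) q  ≡⟨ sumTo-∑-comm (λ w s → 𝟙 (inWindow w s)) q ⟩
      sum (λ w → count (inWindow w) q)              ∎)
      where open ≤-Reasoning

    window-forced : ∀ {w} b → (∀ t → g ≤ t → t < q → ¬ Window (b + t) w) → Window b w
    window-forced {w} b outside =
      toWitness (count-forced (inWindow-periodic w) (≤-trans (m≤m+n g g) g+g≤q) (g≤occurrences w) b
                              λ t g≤t t<q in-t → outside t g≤t t<q (toWitness in-t))

    lens-advance : ∀ {a w} → Ball G k (v a) w → Ball G k (v (a + K)) w →
                   ∃[ w′ ] (E G w w′ × Ball G k (v (suc a)) w′ × Ball G k (v (suc a + K)) w′)
    -- The two balls form the set L centred at v (a + k). The new vertex w′ is the neighbour of w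
    -- on a shortest walk from w to v (a + K + 1) through v (a + K); W_b is the first window
    -- containing D_k(v (a + 1)).
    lens-advance {a} {w} near-a (l , l≤k , W) with unsnocʷ (cons (E-sym G (step (a + K))) W)
    ... | w′ , W′ , e′ = w′ , E-sym G e′ , near-start , near-end
      where
      near-end : Ball G k (v (suc a + K)) w′
      near-end = l , l≤k , W′

      b = suc a ∸ e
      b+e≡1+a : b + e ≡ suc a
      b+e≡1+a = m∸n+n≡m (≤-trans e≤1 (s≤s z≤n))

      near-start : Ball G k (v (suc a)) w′
      near-start with window-forced b (windows-beyond-lens near-a near-end e′ b+e≡1+a) | n≤1⇒n≡0∨n≡1 e≤1
      ... | inj₂ near | _ = subst (λ x → Ball G k (v x) w′) b+e≡1+a near
      ... | inj₁ near | inj₁ e≡0 =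
        subst (λ x → Ball G k (v x) w′) (trans (sym (+-identityʳ b)) (trans (cong (b +_) (sym e≡0)) b+e≡1+a)) near
      ... | inj₁ near | inj₂ e≡1 = ⊥-elim (far-apart near′ (subst (λ x → Ball G k (v x) w′) (sym (+-suc a K)) near-end)
                                                       (n<1+n K) far)
        where
        b≡a : b ≡ a
        b≡a = suc-injective (trans (+-comm 1 b) (trans (cong (b +_) (sym e≡1)) b+e≡1+a))
        near′ : Ball G k (v a) w′
        near′ = subst (λ x → Ball G k (v x) w′) b≡a near
        far : K + suc K < q
        far = ≤-trans (m≤m+n _ (K + 2)) (≤-trans (≤-reflexive (collect k)) q-big)
          where
          collect : ∀ k → suc (k + k + suc (k + k)) + (k + k + 2) ≡ suc (6 * k + 3)
          collect = solve-∀

-- The cycle as a loop, in both directions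

cyclic-gap : ∀ {q r s} .{{_ : NonZero q}} → r < q → s < q →
             ∣ r - (r + s) % q ∣ ⊓ (q ∸ ∣ r - (r + s) % q ∣) ≡ s ⊓ (q ∸ s)
cyclic-gap {q} {r} {s} r<q s<q with r + s <? q
... | yes r+s<q rewrite m<n⇒m%n≡m r+s<q | ∣m-m+n∣≡n r s = refl
... | no  r+s≮q = begin
  ∣ r - (r + s) % q ∣ ⊓ (q ∸ ∣ r - (r + s) % q ∣) ≡⟨ cong (λ d → d ⊓ (q ∸ d)) (trans (cong ∣ r -_∣ wrapped) gap) ⟩
  (q ∸ s) ⊓ (q ∸ (q ∸ s))                         ≡⟨ cong ((q ∸ s) ⊓_) (m∸[m∸n]≡n (<⇒≤ s<q)) ⟩
  (q ∸ s) ⊓ s                                     ≡⟨ ⊓-comm (q ∸ s) s ⟩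
  s ⊓ (q ∸ s)                                     ∎
  where
  open ≡-Reasoning
  x = r + s ∸ q
  x+q≡r+s : x + q ≡ r + s
  x+q≡r+s = m∸n+n≡m (≮⇒≥ r+s≮q)
  x<r : x < r
  x<r = +-cancelʳ-< q x r (subst (_< r + q) (sym x+q≡r+s) (+-monoʳ-< r s<q))
  wrapped : (r + s) % q ≡ x
  wrapped = trans (cong (_% q) (sym x+q≡r+s)) (trans ([m+n]%n≡m%n x q) (m<n⇒m%n≡m (<-trans x<r r<q)))
  gap : ∣ r - x ∣ ≡ q ∸ s
  gap = begin
    ∣ r - x ∣           ≡⟨ m≤n⇒∣n-m∣≡n∸m (<⇒≤ x<r) ⟩
    r ∸ x               ≡⟨ [m+n]∸[m+o]≡n∸o s r x ⟨
    s + r ∸ (s + x)     ≡⟨ cong₂ _∸_ (+-comm s r) (+-comm s x) ⟩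
    r + s ∸ (x + s)     ≡⟨ cong (_∸ (x + s)) x+q≡r+s ⟨
    x + q ∸ (x + s)     ≡⟨ [m+n]∸[m+o]≡n∸o x q s ⟩
    q ∸ s               ∎

module _ (G : Graph) {p : ℕ} (c : Fin (suc p) → V G) (iso : IsIsometricCycle G (suc p) c) where
  private
    q = suc p

    idx : ℕ → Fin q
    idx j = fromℕ< (m%n<n j q)

    toℕ-idx : ∀ j → toℕ (idx j) ≡ j % q
    toℕ-idx j = toℕ-fromℕ< (m%n<n j q)

  at-mod : ∀ {x y} → x % q ≡ y % q → at c x ≡ at c y
  at-mod {x} {y} eq = cong c (toℕ-injective (trans (toℕ-idx x) (trans eq (sym (toℕ-idx y)))))

  at-periodic : Periodic q (at c)
  at-periodic s = at-mod {s + q} {s} ([m+n]%n≡m%n s q)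

  at-step : ∀ s → E G (at c s) (at c (suc s))
  at-step s = IsCycle.edges (proj₁ iso) (idx s) (idx (suc s)) consecutive
    where
    r = s % q
    suc-mod : suc s % q ≡ suc r % q
    suc-mod = trans (cong (λ x → suc x % q) (m≡m%n+[m/n]*n s q)) ([m+kn]%n≡m%n (suc r) (s / q) q)
    consecutive : suc (toℕ (idx s)) ≡ toℕ (idx (suc s)) ⊎ (suc (toℕ (idx s)) ≡ q × toℕ (idx (suc s)) ≡ 0)
    consecutive rewrite toℕ-idx s | toℕ-idx (suc s) | suc-mod with m≤n⇒m<n∨m≡n (m%n<n s q)
    ... | inj₁ 1+r<q = inj₁ (sym (m<n⇒m%n≡m 1+r<q))
    ... | inj₂ 1+r≡q = inj₂ (1+r≡q , trans (cong (_% q) 1+r≡q) (n%n≡0 q))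

  at-isometric : ∀ a s l → s < q → Walk G (at c a) (at c (a + s)) l → s ⊓ (q ∸ s) ≤ l
  at-isometric a s l s<q W = subst (_≤ l) gap (proj₂ (proj₂ iso (idx a) (idx (a + s))) l W)
    where
    shifted : (a + s) % q ≡ (a % q + s) % q
    shifted = begin
      (a + s) % q                 ≡⟨ %-distribˡ-+ a s q ⟩
      (a % q + s % q) % q         ≡⟨ cong (λ x → (x + s % q) % q) (m%n%n≡m%n a q) ⟨
      (a % q % q + s % q) % q     ≡⟨ %-distribˡ-+ (a % q) s q ⟨
      (a % q + s) % q             ∎
      where open ≡-Reasoning
    gap : dCyc G q (idx a) (idx (a + s)) ≡ s ⊓ (q ∸ s)
    gap = trans (cong₂ (λ x y → ∣ x - y ∣ ⊓ (q ∸ ∣ x - y ∣)) (toℕ-idx a) (trans (toℕ-idx (a + s)) shifted))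
                (cyclic-gap (m%n<n a q) s<q)

  cycle-loop : IsIsometricLoop G q (at c)
  cycle-loop = record { periodic = at-periodic ; step = at-step ; isometric = at-isometric }

module _ {G : Graph} {p : ℕ} {v : ℕ → V G} (loop : IsIsometricLoop G (suc p) v) where
  open IsIsometricLoop loop
  open Loop loop

  -- As p ≡ -1 modulo suc p, the sequence s ↦ v (s * p) runs around the loop backwards.
  reflect-index : ∀ {A B} m → A + B ≡ m * suc p → v (A * p) ≡ v B
  reflect-index {A} {B} m eq = begin
    v (A * p)               ≡⟨ periodic-* (A * p) m ⟨
    v (A * p + m * suc p)   ≡⟨ cong (λ x → v (A * p + x)) eq ⟨
    v (A * p + (A + B))     ≡⟨ cong v (regroup A B p) ⟩
    v (B + A * suc p)       ≡⟨ periodic-* B A ⟩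
    v B                     ∎
    where
    open ≡-Reasoning
    regroup : ∀ A B p → A * p + (A + B) ≡ B + A * suc p
    regroup = solve-∀

  reflection : IsIsometricLoop G (suc p) (λ s → v (s * p))
  reflection = record
    { periodic  = λ s → reflect-index (suc s) (around s p)
    ; step      = λ s → E-sym G (subst (E G (v (suc s * p))) (sym (reflect-index (suc s) (around′ s p))) (step (suc s * p)))
    ; isometric = λ a s l s<q W →
        isometric ((a + s) * p) s l s<q
          (subst (λ y → Walk G (v ((a + s) * p)) y l) (reflect-index {A = a} (a + s) (around″ a s p)) (reverseʷ W))
    }
    where
    around : ∀ s p → s + suc p + s * p ≡ suc s * suc p
    around = solve-∀
    around′ : ∀ s p → s + suc (suc s * p) ≡ suc s * suc p
    around′ = solve-∀
    around″ : ∀ a s p → a + ((a + s) * p + s) ≡ (a + s) * suc p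
    around″ = solve-∀

-- Equatorial graphs

moore-odd-≡ : ∀ δ g → g % 2 ≡ 1 → moore δ g ≡ 1 + sumTo (λ i → δ * (δ ∸ 1) ^ i) (kOf g)
moore-odd-≡ δ g odd rewrite odd = refl

moore-even-≡ : ∀ δ g → g % 2 ≡ 0 → moore δ g ≡ 2 + sumTo (λ i → 2 * (δ ∸ 1) ^ suc i) (kOf g)
moore-even-≡ δ g even rewrite even = refl

module EquatorialLoops {G : Graph} {δ g q : ℕ} (EQ : Equatorial G δ g q) where
  open Equatorial EQ
  open Girth G g (proj₂ girth)

  k e : ℕ
  k = kOf g
  e = (g ∸ 1) % 2

  e≤1 : e ≤ 1
  e≤1 = ≤-pred (m%n<n (g ∸ 1) 2)

  g≡1+2k+e : g ≡ suc (k + k + e)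
  g≡1+2k+e = begin
    g                 ≡⟨ m∸n+n≡m (≤-trans (s≤s z≤n) g≥3) ⟨
    g ∸ 1 + 1         ≡⟨ cong (_+ 1) (m≡m%n+[m/n]*n (g ∸ 1) 2) ⟩
    e + k * 2 + 1     ≡⟨ regroup e k ⟩
    suc (k + k + e)   ∎
    where
    open ≡-Reasoning
    regroup : ∀ e k → e + k * 2 + 1 ≡ suc (k + k + e)
    regroup = solve-∀

  g%2≡[1+e]%2 : g % 2 ≡ (1 + e) % 2
  g%2≡[1+e]%2 = trans (cong (_% 2) (trans g≡1+2k+e (regroup k e))) ([m+kn]%n≡m%n (1 + e) k 2)
    where
    regroup : ∀ k e → suc (k + k + e) ≡ 1 + e + k * 2
    regroup = solve-∀

  2k<g : k + k < g
  2k<g = subst (k + k <_) (sym g≡1+2k+e) (s≤s (m≤m+n (k + k) e))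

  module Lens {v} (loop : IsIsometricLoop G q v) where
    open IsIsometricLoop loop
    module W = Windows loop k e e≤1 q-big
    open W using (windowSet)

    moore≤window : ∀ s → moore δ g ≤ ∣ windowSet s ∣
    moore≤window s with n≤1⇒n≡0∨n≡1 e≤1
    ... | inj₁ e≡0 = subst (_≤ ∣ windowSet s ∣) (sym (moore-odd-≡ δ g (trans g%2≡[1+e]%2 (cong (λ b → (1 + b) % 2) e≡0))))
        (moore-odd δ (proj₁ mindeg) (windowSet s) 2k<g (λ near → ∈-tabulate⁺ (fromWitness (inj₁ near))))
    ... | inj₂ e≡1 = subst (_≤ ∣ windowSet s ∣) (sym (moore-even-≡ δ g (trans g%2≡[1+e]%2 (cong (λ b → (1 + b) % 2) e≡1))))
        (moore-even δ (proj₁ mindeg) (windowSet s) short (step s)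
          (λ near → ∈-tabulate⁺ (fromWitness (inj₁ near)))
          (λ {z} near → ∈-tabulate⁺ (fromWitness (inj₂ (subst (λ x → Ball G k (v x) z) 1+s≡s+e near)))))
      where
      short : k + suc k < g
      short = subst (k + suc k <_) (sym (trans g≡1+2k+e (cong (λ b → suc (k + k + b)) e≡1)))
                    (s≤s (≤-reflexive (trans (+-suc k k) (+-comm 1 (k + k)))))
      1+s≡s+e : suc s ≡ s + e
      1+s≡s+e = trans (+-comm 1 s) (cong (s +_) (sym e≡1))

    covered : Graph.n G * W.g ≤ sumTo (λ s → ∣ windowSet s ∣) q
    covered = begin
      Graph.n G * W.g                  ≡⟨ cong (Graph.n G *_) g≡1+2k+e ⟨
      Graph.n G * g                    ≡⟨ order ⟩
      q * moore δ g                    ≤⟨ sumTo-≥ q moore≤window ⟩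
      sumTo (λ s → ∣ windowSet s ∣) q  ∎
      where open ≤-Reasoning

    open W.Tight covered public using (lens-advance)

module Lenses {G : Graph} {δ g p : ℕ} (EQ : Equatorial G δ g (suc p))
              (c : Fin (suc p) → V G) (iso : IsIsometricCycle G (suc p) c) where
  open Equatorial EQ
  open EquatorialLoops EQ
  private
    q = suc p
    u = at c
    loop = cycle-loop G c iso
    module Forward  = Lens loop
    module Backward = Lens (reflection loop)
    open IsIsometricLoop loop using (periodic)

    moved : ∀ {x y w} → x ≡ y → Ball G k x w → Ball G k y w
    moved = subst (λ x → Ball G k x _)

    k≤q : k ≤ q
    k≤q = ≤-trans (m≤n+m k (5 * k + 3)) (≤-trans (≤-reflexive (regroup k)) (<⇒≤ q-big))
      where
      regroup : ∀ k → 5 * k + 3 + k ≡ 6 * k + 3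
      regroup = solve-∀

    -- The index j - k of the first ball of L_j, shifted by q so that ∸ does not truncate.
    module Start (j : ℕ) where
      a : ℕ
      a = j + q ∸ k
      a+k≡j+q : a + k ≡ j + q
      a+k≡j+q = m∸n+n≡m (≤-trans k≤q (m≤n+m q j))

  forward : ∀ j {w} → InL G k q c j w → ∃[ w′ ] (E G w w′ × InL G k q c (suc j) w′)
  forward j {w} (near₁ , near₂) =
    let w′ , e′ , near₁′ , near₂′ = Forward.lens-advance {a = a} {w = w} near₁ (moved (sym end) near₂)
    in  w′ , e′ , moved start′ near₁′ , moved end′ near₂′
    where
    open Start j
    a+2k≡j+k+q : a + (k + k) ≡ j + k + q
    a+2k≡j+k+q = begin
      a + (k + k) ≡⟨ +-assoc a k k ⟨
      a + k + k   ≡⟨ cong (_+ k) a+k≡j+q ⟩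
      j + q + k   ≡⟨ swap j q k ⟩
      j + k + q   ∎
      where
      open ≡-Reasoning
      swap : ∀ j q k → j + q + k ≡ j + k + q
      swap = solve-∀
    end : u (a + (k + k)) ≡ u (j + k)
    end = trans (cong u a+2k≡j+k+q) (periodic (j + k))
    start′ : u (suc a) ≡ u (suc j + q ∸ k)
    start′ = cong u (sym (+-∸-assoc 1 (≤-trans k≤q (m≤n+m q j))))
    end′ : u (suc a + (k + k)) ≡ u (suc j + k)
    end′ = trans (cong (u ∘ suc) a+2k≡j+k+q) (periodic (suc j + k))

  backward : ∀ j {w} → InL G k q c j w → ∃[ w′ ] (E G w w′ × InL G k q c (j + q ∸ 1) w′)
  backward j {w} (near₁ , near₂) =
    let w′ , e′ , near₁′ , near₂′ = Backward.lens-advance {a = b} {w = w} (moved (sym start) near₂) (moved (sym end) near₁)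
    in  w′ , e′ , moved end′ near₂′ , moved start′ near₁′
    where
    open Start j
    open ≡-Reasoning
    b j′ y : ℕ
    b  = (j + k) * p
    j′ = j + q ∸ 1
    y  = j′ + q ∸ k
    j′+1≡j+q : j′ + 1 ≡ j + q
    j′+1≡j+q = m∸n+n≡m (≤-trans (s≤s z≤n) (m≤n+m q j))
    y+k≡j′+q : y + k ≡ j′ + q
    y+k≡j′+q = m∸n+n≡m (≤-trans k≤q (m≤n+m q j′))

    once-round : b + k + (j + q) ≡ suc (j + k) * q
    once-round = regroup j k p
      where
      regroup : ∀ j k p → (j + k) * p + k + (j + suc p) ≡ suc (j + k) * suc p
      regroup = solve-∀

    start : u (b * p) ≡ u (j + k)
    start = reflect-index loop {A = b} {B = j + k} (j + k) (trans (+-comm b (j + k)) (sym (*-suc (j + k) p)))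

    end : u ((b + (k + k)) * p) ≡ u a
    end = reflect-index loop {A = b + (k + k)} {B = a} (suc (j + k)) (begin
      b + (k + k) + a   ≡⟨ regroup b k a ⟩
      b + k + (a + k)   ≡⟨ cong (b + k +_) a+k≡j+q ⟩
      b + k + (j + q)   ≡⟨ once-round ⟩
      suc (j + k) * q   ∎)
      where
      regroup : ∀ b k a → b + (k + k) + a ≡ b + k + (a + k)
      regroup = solve-∀

    start′ : u (suc b * p) ≡ u (j′ + k)
    start′ = reflect-index loop {A = suc b} {B = j′ + k} (suc (j + k)) (begin
      suc b + (j′ + k)  ≡⟨ regroup b k j′ ⟩
      b + k + (j′ + 1)  ≡⟨ cong (b + k +_) j′+1≡j+q ⟩
      b + k + (j + q)   ≡⟨ once-round ⟩
      suc (j + k) * q   ∎)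
      where
      regroup : ∀ b k j′ → suc b + (j′ + k) ≡ b + k + (j′ + 1)
      regroup = solve-∀

    end′ : u ((suc b + (k + k)) * p) ≡ u y
    end′ = reflect-index loop {A = suc b + (k + k)} {B = y} (suc (suc (j + k))) (begin
      suc b + (k + k) + y     ≡⟨ regroup b k y ⟩
      b + k + (y + k + 1)     ≡⟨ cong (λ x → b + k + (x + 1)) y+k≡j′+q ⟩
      b + k + (j′ + q + 1)    ≡⟨ regroup′ b k j′ q ⟩
      b + k + (j′ + 1) + q    ≡⟨ cong (λ x → b + k + x + q) j′+1≡j+q ⟩
      b + k + (j + q) + q     ≡⟨ cong (_+ q) once-round ⟩
      suc (j + k) * q + q     ≡⟨ +-comm _ q ⟩
      suc (suc (j + k)) * q   ∎)
      where
      regroup : ∀ b k y → suc b + (k + k) + y ≡ b + k + (y + k + 1)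
      regroup = solve-∀
      regroup′ : ∀ b k j′ q → b + k + (j′ + q + 1) ≡ b + k + (j′ + 1) + q
      regroup′ = solve-∀

corollary23 : (G : Graph) (δ g q : ℕ) → Equatorial G δ g q →
              (c : Fin q → V G) → IsIsometricCycle G q c → .{{_ : NonZero q}} →
              (i : Fin q) (u : V G) → InL G (kOf g) q c (toℕ i) u →
              (∃[ w ] (E G u w × InL G (kOf g) q c (toℕ i + q ∸ 1) w))
              × (∃[ w ] (E G u w × InL G (kOf g) q c (suc (toℕ i)) w))
corollary23 G δ g zero    EQ c iso () u inL
corollary23 G δ g (suc p) EQ c iso i  u inL = backward (toℕ i) inL , forward (toℕ i) inL
  where open Lenses EQ c iso
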